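{- Work constructively (intuitionistic logic with countable choice). Let $(f_n)_{n \geq 1}$ be a sequence of functions $f_n : \mathbb{N}_\infty \to \mathbb{N}$ such that $f_n(x) \to 0$ for every $x \in \mathbb{N}_\infty$. Then: (1) For every $\gamma \in \mathbb{N}_\infty$: either there exists $i \in \mathbb{N}$ with $f_i(\gamma) \neq 0$, or $f_i(\gamma) = 0$ for all $i \in \mathbb{N}$. (2) Either there exist $i \in \mathbb{N}$ and $\alpha \in \mathbb{N}_\infty$ such that $f_i(\alpha) \neq 0$, or for all $i \in \mathbb{N}$ and all $\alpha \in \mathbb{N}_\infty$ we have $f_i(\alpha) = 0$.
   Context: $\mathbb{N}_\infty$ is the set of all increasing binary sequences $\alpha : \mathbb{N} \to \{0,1\}$ (i.e. $\alpha(k) \le \alpha(k+1)$), with the metric inherited from Cantor space $2^{\mathbb{N}}$. Since $\mathbb{N}$ is discrete, $f_n(x) \to 0$ means there exists $N$ with $f_n(x) = 0$ for all $n \geq N$. The disjunctions are meant constructively (one can decide which alternative holds). -}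

module Defs where

open import Data.Nat using (ℕ; suc)
open import Data.Bool using (Bool; _≤_)
open import Data.Product using (Σ; proj₁)
open import Relation.Binary.PropositionalEquality using (_≡_)

IsIncreasing : (ℕ → Bool) → Set
IsIncreasing α = ∀ k → α k ≤ α (suc k)

ℕ∞ : Set
ℕ∞ = Σ (ℕ → Bool) IsIncreasing

_≈∞_ : ℕ∞ → ℕ∞ → Set
x ≈∞ y = ∀ k → proj₁ x k ≡ proj₁ y k

Extensional : (ℕ∞ → ℕ) → Set
Extensional g = ∀ x y → x ≈∞ y → g x ≡ g y

-- f n x → 0 in the discrete space ℕ: eventually zero
TendsToZeroAt : (ℕ → ℕ∞ → ℕ) → ℕ∞ → Set
TendsToZeroAt f x = Σ ℕ λ N → ∀ n → N Data.Nat.≤ n → f n x ≡ 0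

-- (1) is a bounded search: only the finitely many indices below the point
-- from which f i γ vanishes need inspecting. (2) then follows from Escardó's
-- omniscience of ℕ∞ applied to the extensional predicate "f i α ≡ 0 for all
-- i". For an extensional p : ℕ∞ → Bool, the sequence ε that switches to true
-- at the first n with p (ι n) ≡ false is a universal counterexample: if
-- p ε ≡ true then ε never switches, so ε ≈ ∞ and p holds at every ι n and at
-- ∞; an x at which p failed would differ from every ι n, forcing x ≈ ∞.
module Submission where

open import Defs
open import Data.Bool using (Bool; true; false; not; _∨_; b≤b; f≤t) renaming (_≤_ to _≤ᵇ_)
open import Data.Bool.Properties using (≤-minimum; ¬-not; not-injective; ∨-conicalʳ)
  renaming (≤-trans to ≤ᵇ-trans)
open import Data.Empty using (⊥-elim)
open import Data.Nat using (ℕ; zero; suc; _≤_; _<_; _≤′_; ≤′-refl; ≤′-step; s≤s; _≟_)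
open import Data.Nat.Properties using (≤⇒≤′; anyUpTo?; <-≤-connex)
open import Data.Product using (Σ; _×_; _,_; proj₁; proj₂)
open import Data.Sum using (_⊎_; inj₁; inj₂; [_,_]′)
import Data.Sum as Sum
open import Function using (_∘_)
open import Relation.Nullary using (¬_; yes; no; ¬?)
open import Relation.Nullary.Decidable using (decidable-stable)
open import Relation.Unary using (Decidable)
open import Relation.Binary.PropositionalEquality using (_≡_; _≢_; refl; sym; trans; cong; cong₂)

Eventually : (ℕ → Set) → Set
Eventually P = Σ ℕ λ N → ∀ n → N ≤ n → P n

eventually⇒∃¬⊎∀ : {P : ℕ → Set} → Decidable P → Eventually P
                → (Σ ℕ (¬_ ∘ P)) ⊎ (∀ n → P n)
eventually⇒∃¬⊎∀ {P} P? (N , P≥N) with anyUpTo? (¬? ∘ P?) N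
... | yes (n , _ , ¬Pn) = inj₁ (n , ¬Pn)
... | no ∄¬P = inj₂ λ n → [ P<N n , P≥N n ]′ (<-≤-connex n N)
  where
  P<N : ∀ n → n < N → P n
  P<N n n<N = decidable-stable (P? n) λ ¬Pn → ∄¬P (n , n<N , ¬Pn)

monotone : (x : ℕ∞) {m n : ℕ} → m ≤ n → proj₁ x m ≤ᵇ proj₁ x n
monotone x {m} m≤n = go (≤⇒≤′ m≤n)
  where
  go : ∀ {n} → m ≤′ n → proj₁ x m ≤ᵇ proj₁ x n
  go ≤′-refl = b≤b
  go (≤′-step {n} m≤′n) = ≤ᵇ-trans (go m≤′n) (proj₂ x n)

true-upward : (x : ℕ∞) {m n : ℕ} → m ≤ n → proj₁ x m ≡ true → proj₁ x n ≡ true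
true-upward x {m} {n} m≤n xm with proj₁ x m | proj₁ x n | monotone x m≤n | xm
... | _ | _ | b≤b | refl = refl
... | _ | _ | f≤t | _    = refl

false-downward : (x : ℕ∞) {m n : ℕ} → m ≤ n → proj₁ x n ≡ false → proj₁ x m ≡ false
false-downward x {m} {n} m≤n xn with proj₁ x m | proj₁ x n | monotone x m≤n | xn
... | _ | _ | b≤b | refl = refl
... | _ | _ | f≤t | ()

ι-seq : ℕ → ℕ → Bool
ι-seq zero    _       = true
ι-seq (suc n) zero    = false
ι-seq (suc n) (suc k) = ι-seq n k

ι-seq-increasing : ∀ n → IsIncreasing (ι-seq n)
ι-seq-increasing zero    k       = b≤b
ι-seq-increasing (suc n) zero    = ≤-minimum (ι-seq n 0)
ι-seq-increasing (suc n) (suc k) = ι-seq-increasing n k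

ι : ℕ → ℕ∞
ι n = ι-seq n , ι-seq-increasing n

∞ : ℕ∞
∞ = (λ _ → false) , λ _ → b≤b

ι-below : ∀ {n k} → k < n → ι-seq n k ≡ false
ι-below {suc n} {zero}  _         = refl
ι-below {suc n} {suc k} (s≤s k<n) = ι-below k<n

ι-above : ∀ {n k} → n ≤ k → ι-seq n k ≡ true
ι-above {zero}          _         = refl
ι-above {suc n} {suc k} (s≤s n≤k) = ι-above n≤k

≈ι : (x : ℕ∞) {n : ℕ} → proj₁ x n ≡ true → (∀ {k} → k < n → proj₁ x k ≡ false) → x ≈∞ ι n
≈ι x {n} xn below k = [ lower , upper ]′ (<-≤-connex k n)
  where
  lower : k < n → proj₁ x k ≡ ι-seq n k
  lower k<n = trans (below k<n) (sym (ι-below k<n))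
  upper : n ≤ k → proj₁ x k ≡ ι-seq n k
  upper n≤k = trans (true-upward x n≤k xn) (sym (ι-above n≤k))

≈ι-zero : (x : ℕ∞) → proj₁ x 0 ≡ true → x ≈∞ ι 0
≈ι-zero x x0 = ≈ι x x0 λ ()

≈ι-suc : (x : ℕ∞) {n : ℕ} → proj₁ x n ≡ false → proj₁ x (suc n) ≡ true → x ≈∞ ι (suc n)
≈ι-suc x xn x1+n = ≈ι x x1+n λ { (s≤s k≤n) → false-downward x k≤n xn }

≉ι⇒≈∞ : (x : ℕ∞) → (∀ n → ¬ x ≈∞ ι n) → x ≈∞ ∞
≉ι⇒≈∞ x x≉ι zero    = ¬-not (x≉ι 0 ∘ ≈ι-zero x)
≉ι⇒≈∞ x x≉ι (suc n) = ¬-not (x≉ι (suc n) ∘ ≈ι-suc x (≉ι⇒≈∞ x x≉ι n))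

module Omniscience (p : ℕ∞ → Bool) (p-ext : ∀ x y → x ≈∞ y → p x ≡ p y) where

  separated : {x y : ℕ∞} → p x ≡ false → p y ≡ true → ¬ x ≈∞ y
  separated px py x≈y with () ← trans (sym px) (trans (p-ext _ _ x≈y) py)

  density : (∀ n → p (ι n) ≡ true) → p ∞ ≡ true → ∀ x → p x ≡ true
  density pι p∞ x = ¬-not λ px → separated px p∞ (≉ι⇒≈∞ x λ n → separated px (pι n))

  ε-seq : ℕ → Bool
  ε-seq zero    = not (p (ι 0))
  ε-seq (suc n) = ε-seq n ∨ not (p (ι (suc n)))

  ε-seq-increasing : IsIncreasing ε-seq
  ε-seq-increasing n with ε-seq n
  ... | true  = b≤b
  ... | false = ≤-minimum _

  ε : ℕ∞
  ε = ε-seq , ε-seq-increasing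

  ε-seq≡false⇒pι≡true : ∀ n → ε-seq n ≡ false → p (ι n) ≡ true
  ε-seq≡false⇒pι≡true zero    = not-injective
  ε-seq≡false⇒pι≡true (suc n) = not-injective ∘ ∨-conicalʳ (ε-seq n) _

  pε≡true⇒ε-seq≡false : p ε ≡ true → ∀ n → ε-seq n ≡ false
  pε≡true⇒ε-seq≡false pε zero with p (ι 0) in pι0
  ... | true  = refl
  ... | false = ⊥-elim (separated pι0 pε λ k → sym (≈ι-zero ε (cong not pι0) k))
  pε≡true⇒ε-seq≡false pε (suc n) with p (ι (suc n)) in pι | pε≡true⇒ε-seq≡false pε n
  ... | true  | εn = cong (_∨ false) εn
  ... | false | εn = ⊥-elim (separated pι pε λ k → sym (≈ι-suc ε εn (cong₂ _∨_ εn (cong not pι)) k))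

  ℕ∞-omniscient : (Σ ℕ∞ λ x → p x ≡ false) ⊎ (∀ x → p x ≡ true)
  ℕ∞-omniscient with p ε in pε
  ... | false = inj₁ (ε , pε)
  ... | true  = inj₂ (density pι p∞)
    where
    ε≈∞ : ε ≈∞ ∞
    ε≈∞ = pε≡true⇒ε-seq≡false pε
    pι : ∀ n → p (ι n) ≡ true
    pι n = ε-seq≡false⇒pι≡true n (ε≈∞ n)
    p∞ : p ∞ ≡ true
    p∞ = trans (sym (p-ext ε ∞ ε≈∞)) pε

ℕ∞-∃⊎∀ : {P Q : ℕ∞ → Set}
       → (∀ x y → x ≈∞ y → P x → P y) → (∀ {x} → Q x → ¬ P x) → (∀ x → Q x ⊎ P x)
       → (Σ ℕ∞ Q) ⊎ (∀ x → P x)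
ℕ∞-∃⊎∀ {P} {Q} P-ext Q⇒¬P Q⊎P =
  Sum.map (λ (x , dx) → x , decide≡false⇒Q x dx) (λ d x → decide≡true⇒P x (d x))
          (Omniscience.ℕ∞-omniscient decide decide-ext)
  where
  decide : ℕ∞ → Bool
  decide = [ (λ _ → false) , (λ _ → true) ]′ ∘ Q⊎P

  decide-ext : ∀ x y → x ≈∞ y → decide x ≡ decide y
  decide-ext x y x≈y with Q⊎P x | Q⊎P y
  ... | inj₁ _  | inj₁ _  = refl
  ... | inj₂ _  | inj₂ _  = refl
  ... | inj₁ qx | inj₂ py = ⊥-elim (Q⇒¬P qx (P-ext y x (λ k → sym (x≈y k)) py))
  ... | inj₂ px | inj₁ qy = ⊥-elim (Q⇒¬P qy (P-ext x y x≈y px))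

  decide≡false⇒Q : ∀ x → decide x ≡ false → Q x
  decide≡false⇒Q x _ with Q⊎P x
  ... | inj₁ qx = qx

  decide≡true⇒P : ∀ x → decide x ≡ true → P x
  decide≡true⇒P x _ with Q⊎P x
  ... | inj₂ px = px

lemma5 : (f : ℕ → ℕ∞ → ℕ)
       → (∀ n → Extensional (f n))
       → (∀ x → TendsToZeroAt f x)
       → (∀ γ → (Σ ℕ λ i → f i γ ≢ 0) ⊎ (∀ i → f i γ ≡ 0))
         × ((Σ ℕ λ i → Σ ℕ∞ λ α → f i α ≢ 0) ⊎ (∀ i → ∀ α → f i α ≡ 0))
lemma5 f f-ext f→0 = vanishes? , Sum.map (λ (α , i , fiα≢0) → i , α , fiα≢0) (λ f≡0 i α → f≡0 α i)
                                         (ℕ∞-∃⊎∀ vanishing-ext (λ (i , fiα≢0) f≡0 → fiα≢0 (f≡0 i)) vanishes?)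
  where
  vanishes? : ∀ γ → (Σ ℕ λ i → f i γ ≢ 0) ⊎ (∀ i → f i γ ≡ 0)
  vanishes? γ = eventually⇒∃¬⊎∀ (λ i → f i γ ≟ 0) (f→0 γ)

  vanishing-ext : ∀ α β → α ≈∞ β → (∀ i → f i α ≡ 0) → ∀ i → f i β ≡ 0
  vanishing-ext α β α≈β f≡0 i = trans (sym (f-ext i α β α≈β)) (f≡0 i)
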